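{- Let $\Gamma$ be a finite simple graph and let $\omega\ge 2$ be an integer such that $\Gamma$ is $\omega$-clique regular. Then $\omega=2$ or $\omega=\omega(\Gamma)$, where $\omega(\Gamma)$ denotes the clique number of $\Gamma$ (the order of a largest clique of $\Gamma$).
   Context: All graphs are finite, without loops or parallel edges. A clique of order $\omega$ is a set of $\omega$ pairwise adjacent vertices. A graph $\Gamma$ is called $\omega$-clique regular if its edge set is nonempty and every edge of $\Gamma$ is contained in exactly one clique of order $\omega$. -}

module Defs where

open import Data.Nat using (ℕ; _≤_)
open import Data.Fin using (Fin)
open import Data.Fin.Subset using (Subset; _∈_; ∣_∣)
open import Data.Product using (Σ; ∃; _×_; _,_)
open import Relation.Nullary using (¬_; Dec)
open import Relation.Binary.PropositionalEquality using (_≡_; _≢_)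

record Graph (n : ℕ) : Set₁ where
  field
    Adj     : Fin n → Fin n → Set
    irrefl  : ∀ u → ¬ Adj u u
    sym     : ∀ {u v} → Adj u v → Adj v u
    adj?    : ∀ u v → Dec (Adj u v)

open Graph public

IsClique : ∀ {n} → Graph n → Subset n → Set
IsClique Γ C = ∀ u v → u ∈ C → v ∈ C → u ≢ v → Adj Γ u v

IsCliqueOfOrder : ∀ {n} → Graph n → ℕ → Subset n → Set
IsCliqueOfOrder Γ k C = IsClique Γ C × ∣ C ∣ ≡ k

CliqueRegular : ∀ {n} → Graph n → ℕ → Set
CliqueRegular Γ ω =
  (∃ λ u → ∃ λ v → Adj Γ u v) ×
  (∀ u v → Adj Γ u v →
     Σ (Subset _) λ C →
       (IsCliqueOfOrder Γ ω C × u ∈ C × v ∈ C) ×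
       (∀ D → IsCliqueOfOrder Γ ω D → u ∈ D → v ∈ D → D ≡ C))

IsCliqueNumber : ∀ {n} → Graph n → ℕ → Set
IsCliqueNumber Γ k =
  (∃ λ C → IsCliqueOfOrder Γ k C) ×
  (∀ C → IsClique Γ C → ∣ C ∣ ≤ k)

-- If ω ≥ 3 and K were a clique with more than ω vertices, pick an edge uv of K,
-- an ω-subclique C of K through uv, and a vertex w ∈ K outside C. Since ω ≥ 3,
-- {u, v, w} extends to an ω-subclique D of K; then C and D are two different
-- ω-cliques through the edge uv. So every clique has order at most ω, and the
-- ω-clique through any edge attains it.
module Submission where

open import Defs
open import Data.Nat using (ℕ; suc; _+_; _≤_; _<_; _≤?_; z≤n; s≤s)
open import Data.Nat.Properties
  using (≤-trans; ≤-reflexive; ≤-antisym; ≰⇒>; ≮⇒≥; <⇒≱; ≤-<-trans; <⇒≤;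
         +-suc; +-monoʳ-≤; n≤1+n; n≤0⇒n≡0; m≤n⇒m<n∨m≡n; module ≤-Reasoning)
open import Data.Fin using (Fin)
open import Data.Fin.Properties using (any?)
open import Data.Fin.Subset
open import Data.Fin.Subset.Properties
open import Data.Vec using ([]; _∷_; here)
open import Data.Product using (∃; _×_; _,_; proj₂)
open import Data.Empty using (⊥-elim)
open import Data.Sum using (_⊎_; inj₁; inj₂; [_,_]′)
open import Function using (_∘_)
open import Relation.Nullary using (¬_; yes; no; _×-dec_; ¬?)
open import Relation.Nullary.Decidable using (decidable-stable)
open import Relation.Binary.PropositionalEquality
  using (_≡_; _≢_; cong; subst; ≢-sym)
import Relation.Binary.PropositionalEquality as ≡

∣p∪q∣≤∣p∣+∣q∣ : ∀ {n} (p q : Subset n) → ∣ p ∪ q ∣ ≤ ∣ p ∣ + ∣ q ∣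
∣p∪q∣≤∣p∣+∣q∣ []            []            = z≤n
∣p∪q∣≤∣p∣+∣q∣ (outside ∷ p) (outside ∷ q) = ∣p∪q∣≤∣p∣+∣q∣ p q
∣p∪q∣≤∣p∣+∣q∣ (outside ∷ p) (inside  ∷ q) =
  ≤-trans (s≤s (∣p∪q∣≤∣p∣+∣q∣ p q)) (≤-reflexive (≡.sym (+-suc ∣ p ∣ ∣ q ∣)))
∣p∪q∣≤∣p∣+∣q∣ (inside  ∷ p) (outside ∷ q) = s≤s (∣p∪q∣≤∣p∣+∣q∣ p q)
∣p∪q∣≤∣p∣+∣q∣ (inside  ∷ p) (inside  ∷ q) =
  s≤s (≤-trans (∣p∪q∣≤∣p∣+∣q∣ p q) (+-monoʳ-≤ ∣ p ∣ (n≤1+n ∣ q ∣)))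

∣⁅x⁆∪p∣≤1+∣p∣ : ∀ {n} (x : Fin n) (p : Subset n) → ∣ ⁅ x ⁆ ∪ p ∣ ≤ suc ∣ p ∣
∣⁅x⁆∪p∣≤1+∣p∣ x p = begin
  ∣ ⁅ x ⁆ ∪ p ∣       ≤⟨ ∣p∪q∣≤∣p∣+∣q∣ ⁅ x ⁆ p ⟩
  ∣ ⁅ x ⁆ ∣ + ∣ p ∣   ≡⟨ cong (_+ ∣ p ∣) (∣⁅x⁆∣≡1 x) ⟩
  suc ∣ p ∣           ∎
  where open ≤-Reasoning

⁅x⁆⊆p : ∀ {n} {x : Fin n} {p} → x ∈ p → ⁅ x ⁆ ⊆ p
⁅x⁆⊆p {x = x} {p} x∈p y∈⁅x⁆ = subst (_∈ p) (≡.sym (x∈⁅y⁆⇒x≡y x y∈⁅x⁆)) x∈p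

∪-⊆ : ∀ {n} {p q r : Subset n} → p ⊆ r → q ⊆ r → p ∪ q ⊆ r
∪-⊆ {p = p} {q} p⊆r q⊆r = [ p⊆r , q⊆r ]′ ∘ x∈p∪q⁻ p q

pair : ∀ {n} → Fin n → Fin n → Subset n
pair x y = ⁅ x ⁆ ∪ ⁅ y ⁆

module _ {n} {x y : Fin n} where

  x∈pair : x ∈ pair x y
  x∈pair = x∈p∪q⁺ (inj₁ (x∈⁅x⁆ x))

  y∈pair : y ∈ pair x y
  y∈pair = x∈p∪q⁺ (inj₂ (x∈⁅x⁆ y))

  pair⊆ : ∀ {p} → x ∈ p → y ∈ p → pair x y ⊆ p
  pair⊆ x∈p y∈p = ∪-⊆ (⁅x⁆⊆p x∈p) (⁅x⁆⊆p y∈p)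

∣pair∣≤2 : ∀ {n} (x y : Fin n) → ∣ pair x y ∣ ≤ 2
∣pair∣≤2 x y = ≤-trans (∣⁅x⁆∪p∣≤1+∣p∣ x ⁅ y ⁆) (s≤s (≤-reflexive (∣⁅x⁆∣≡1 y)))

∣q∣<∣p∣⇒∃∈p∉q : ∀ {n} (p q : Subset n) → ∣ q ∣ < ∣ p ∣ → ∃ λ x → x ∈ p × x ∉ q
∣q∣<∣p∣⇒∃∈p∉q p q ∣q∣<∣p∣ with any? (λ x → x ∈? p ×-dec ¬? (x ∈? q))
... | yes witness = witness
... | no ¬witness = ⊥-elim (<⇒≱ ∣q∣<∣p∣ (p⊆q⇒∣p∣≤∣q∣ p⊆q))
  where
  p⊆q : p ⊆ q
  p⊆q {x} x∈p = decidable-stable (x ∈? q) (λ x∉q → ¬witness (x , x∈p , x∉q))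

∃-two-distinct : ∀ {n} (p : Subset n) → 1 < ∣ p ∣ → ∃ λ x → ∃ λ y → x ∈ p × y ∈ p × x ≢ y
∃-two-distinct {n} p 1<∣p∣
  with ∣q∣<∣p∣⇒∃∈p∉q p ⊥ (≤-<-trans (≤-trans (≤-reflexive (∣⊥∣≡0 n)) z≤n) 1<∣p∣)
... | x , x∈p , _ with ∣q∣<∣p∣⇒∃∈p∉q p ⁅ x ⁆ (≤-<-trans (≤-reflexive (∣⁅x⁆∣≡1 x)) 1<∣p∣)
... | y , y∈p , y∉⁅x⁆ = x , y , x∈p , y∈p , ≢-sym (x∉⁅y⁆⇒x≢y y∉⁅x⁆)

∃-⊆-between-of-size : ∀ {n} (m : ℕ) (T S : Subset n) → T ⊆ S → ∣ T ∣ ≤ m → m ≤ ∣ S ∣ →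
  ∃ λ D → T ⊆ D × D ⊆ S × ∣ D ∣ ≡ m
∃-⊆-between-of-size m [] [] _ _ m≤0 = [] , ⊆-refl , ⊆-refl , ≡.sym (n≤0⇒n≡0 m≤0)
∃-⊆-between-of-size m (inside ∷ T) (outside ∷ S) T⊆S _ _ with T⊆S here
... | ()
∃-⊆-between-of-size m (outside ∷ T) (outside ∷ S) T⊆S ∣T∣≤m m≤∣S∣
  with ∃-⊆-between-of-size m T S (drop-∷-⊆ T⊆S) ∣T∣≤m m≤∣S∣
... | D , T⊆D , D⊆S , ∣D∣≡m = outside ∷ D , out⊆ T⊆D , out⊆ D⊆S , ∣D∣≡m
∃-⊆-between-of-size (suc m) (inside ∷ T) (inside ∷ S) T⊆S (s≤s ∣T∣≤m) (s≤s m≤∣S∣)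
  with ∃-⊆-between-of-size m T S (drop-∷-⊆ T⊆S) ∣T∣≤m m≤∣S∣
... | D , T⊆D , D⊆S , ∣D∣≡m = inside ∷ D , in⊆in T⊆D , in⊆in D⊆S , cong suc ∣D∣≡m
∃-⊆-between-of-size m (outside ∷ T) (inside ∷ S) T⊆S ∣T∣≤m m≤1+∣S∣ with m ≤? ∣ S ∣
... | yes m≤∣S∣ with ∃-⊆-between-of-size m T S (drop-∷-⊆ T⊆S) ∣T∣≤m m≤∣S∣
...   | D , T⊆D , D⊆S , ∣D∣≡m = outside ∷ D , out⊆ T⊆D , out⊆ D⊆S , ∣D∣≡m
∃-⊆-between-of-size m (outside ∷ T) (inside ∷ S) T⊆S ∣T∣≤m m≤1+∣S∣ | no m≰∣S∣ =
  inside ∷ S , T⊆S , ⊆-refl , ≤-antisym (≰⇒> m≰∣S∣) m≤1+∣S∣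

module _ {n} (Γ : Graph n) where

  IsClique-⊆ : ∀ {C K} → C ⊆ K → IsClique Γ K → IsClique Γ C
  IsClique-⊆ C⊆K K-clique u v u∈C v∈C = K-clique u v (C⊆K u∈C) (C⊆K v∈C)

  ∃-subclique-of-order : ∀ {K} m T → IsClique Γ K → T ⊆ K → ∣ T ∣ ≤ m → m ≤ ∣ K ∣ →
    ∃ λ C → IsCliqueOfOrder Γ m C × T ⊆ C
  ∃-subclique-of-order {K} m T K-clique T⊆K ∣T∣≤m m≤∣K∣
    with ∃-⊆-between-of-size m T K T⊆K ∣T∣≤m m≤∣K∣
  ... | C , T⊆C , C⊆K , ∣C∣≡m = C , (IsClique-⊆ C⊆K K-clique , ∣C∣≡m) , T⊆C

  AtMostOneCliquePerEdge : ℕ → Set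
  AtMostOneCliquePerEdge ω = ∀ {u v C D} → Adj Γ u v →
    IsCliqueOfOrder Γ ω C → u ∈ C → v ∈ C →
    IsCliqueOfOrder Γ ω D → u ∈ D → v ∈ D → C ≡ D

  CliqueRegular⇒AtMostOneCliquePerEdge : ∀ {ω} → CliqueRegular Γ ω → AtMostOneCliquePerEdge ω
  CliqueRegular⇒AtMostOneCliquePerEdge (_ , regular) {u} {v} {C} {D}
    uv C-order u∈C v∈C D-order u∈D v∈D =
    ≡.trans (unique C C-order u∈C v∈C) (≡.sym (unique D D-order u∈D v∈D))
    where unique = proj₂ (proj₂ (regular u v uv))

  ∃-two-ω-cliques-through : ∀ {ω K u v} → 3 ≤ ω → IsClique Γ K → ω < ∣ K ∣ → u ∈ K → v ∈ K →
    ∃ λ C → ∃ λ D → (IsCliqueOfOrder Γ ω C × u ∈ C × v ∈ C) ×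
                    (IsCliqueOfOrder Γ ω D × u ∈ D × v ∈ D) × C ≢ D
  ∃-two-ω-cliques-through {ω} {K} {u} {v} 3≤ω K-clique ω<∣K∣ u∈K v∈K
    with ∃-subclique-of-order ω (pair u v) K-clique (pair⊆ u∈K v∈K)
           (≤-trans (≤-trans (∣pair∣≤2 u v) (n≤1+n 2)) 3≤ω) (<⇒≤ ω<∣K∣)
  ... | C , C-order , uv⊆C
    with ∣q∣<∣p∣⇒∃∈p∉q K C (≤-<-trans (≤-reflexive (proj₂ C-order)) ω<∣K∣)
  ... | w , w∈K , w∉C
    with ∃-subclique-of-order ω (⁅ w ⁆ ∪ pair u v) K-clique
           (∪-⊆ (⁅x⁆⊆p w∈K) (pair⊆ u∈K v∈K))
           (≤-trans (≤-trans (∣⁅x⁆∪p∣≤1+∣p∣ w (pair u v)) (s≤s (∣pair∣≤2 u v))) 3≤ω) (<⇒≤ ω<∣K∣)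
  ... | D , D-order , wuv⊆D =
    C , D , (C-order , uv⊆C x∈pair , uv⊆C y∈pair) ,
    (D-order , uv⊆D x∈pair , uv⊆D y∈pair) , λ C≡D → w∉C (subst (w ∈_) (≡.sym C≡D) w∈D)
    where
    uv⊆D : pair u v ⊆ D
    uv⊆D = wuv⊆D ∘ q⊆p∪q ⁅ w ⁆ (pair u v)
    w∈D : w ∈ D
    w∈D = wuv⊆D (p⊆p∪q (pair u v) (x∈⁅x⁆ w))

  cliques-have-order-≤ : ∀ {ω} → 3 ≤ ω → AtMostOneCliquePerEdge ω →
    ∀ K → IsClique Γ K → ∣ K ∣ ≤ ω
  cliques-have-order-≤ {ω} 3≤ω at-most-one K K-clique = ≮⇒≥ no-larger
    where
    no-larger : ¬ ω < ∣ K ∣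
    no-larger ω<∣K∣ with ∃-two-distinct K (≤-<-trans (≤-trans (s≤s z≤n) 3≤ω) ω<∣K∣)
    ... | u , v , u∈K , v∈K , u≢v
      with ∃-two-ω-cliques-through 3≤ω K-clique ω<∣K∣ u∈K v∈K
    ... | C , D , (C-order , u∈C , v∈C) , (D-order , u∈D , v∈D) , C≢D =
      C≢D (at-most-one (K-clique u v u∈K v∈K u≢v) C-order u∈C v∈C D-order u∈D v∈D)

proposition1p1 : ∀ {n} (Γ : Graph n) (ω : ℕ) → 2 ≤ ω → CliqueRegular Γ ω →
    ω ≡ 2 ⊎ IsCliqueNumber Γ ω
proposition1p1 Γ ω 2≤ω regular@((u , v , uv) , through) with m≤n⇒m<n∨m≡n 2≤ω
... | inj₂ 2≡ω = inj₁ (≡.sym 2≡ω)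
... | inj₁ 3≤ω with through u v uv
...   | C , (C-order , _) , _ =
  inj₂ ((C , C-order) , cliques-have-order-≤ Γ 3≤ω (CliqueRegular⇒AtMostOneCliquePerEdge Γ regular))
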